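{- Let $G$ be a connected unicyclic graph that is not König–Egerváry. Consider any sequence of steps of the procedure below that produces $G$, and let $B$ and $R$ be the sets of black and red vertices of the resulting coloring. Then $d_c(G) = |B| - |R| = \alpha(G) - \mu(G)$. Procedure: (1) Construct an odd cycle and color its vertices blue. (2) Either perform step (3), or perform step (4), or stop. (3) Choose any existing vertex $u$, add two new vertices $u_1,u_2$ and edges $uu_1, u_1u_2$; color $u_1$ red and $u_2$ black; go to (2). (4) If there is a red vertex, choose a red vertex $u$, add a new vertex $u_1$ and the edge $uu_1$, color $u_1$ black; go to (2).
   Context: All graphs are finite and simple. $\alpha(G)$ is the maximum size of an independent set and $\mu(G)$ the maximum size of a matching. $G$ is König–Egerváry if $\alpha(G)+\mu(G)=|V(G)|$. A graph is unicyclic if it contains exactly one cycle. For $A \subseteq V(G)$, $N(A)$ is the set of vertices adjacent to some vertex of $A$; $d(X)=|X|-|N(X)|$ and $d_c(G)=\max\{d(X): X\subseteq V(G)\}$. Every connected unicyclic non-König–Egerváry graph is (isomorphic to a graph) produced by the procedure. -}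

module Defs where

open import Data.Nat as ℕ using (ℕ; zero; suc; _+_; _<_; _≤_; _≟_)
open import Data.Integer as ℤ using (ℤ; +_)
open import Data.Fin using (Fin; toℕ)
open import Data.Fin.Subset using (Subset; _∈_; ∣_∣)
open import Data.Vec using (tabulate)
open import Data.Bool using (Bool; true; false)
open import Data.List using (List; []; _∷_; _++_; [_]; zip; map; upTo; length; concatMap)
open import Data.List.Membership.Propositional as L using ()
open import Data.List.Relation.Unary.All using (All)
open import Data.List.Relation.Unary.Unique.Propositional using (Unique)
open import Data.Product using (Σ; _×_; _,_; ∃; ∃-syntax; uncurry)
open import Data.Sum using (_⊎_)
open import Relation.Nullary using (¬_; yes; no)
open import Relation.Binary.PropositionalEquality using (_≡_; _≢_)
open import Function.Bundles using (_⇔_; _↔_; Inverse)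

record Graph (n : ℕ) : Set₁ where
  field
    Adj   : Fin n → Fin n → Set
    sym   : ∀ {u v} → Adj u v → Adj v u
    irrefl : ∀ {u} → ¬ Adj u u
open Graph public

module _ {n : ℕ} (G : Graph n) where

  data Reach : Fin n → Fin n → Set where
    here : ∀ {u} → Reach u u
    step : ∀ {u v w} → Adj G u v → Reach v w → Reach u w

  Connected : Set
  Connected = ∀ u v → Reach u v

  cycPairs : List (Fin n) → List (Fin n × Fin n)
  cycPairs []       = []
  cycPairs (x ∷ xs) = zip (x ∷ xs) (xs ++ [ x ])

  record Cycle : Set where
    field
      verts    : List (Fin n)
      long     : 3 ≤ length verts
      distinct : Unique verts
      adjacent : All (uncurry (Adj G)) (cycPairs verts)

  CycEdge : Cycle → Fin n → Fin n → Set
  CycEdge C u v = (u , v) L.∈ cycPairs (Cycle.verts C) ⊎ (v , u) L.∈ cycPairs (Cycle.verts C)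

  -- exactly one cycle (cycles identified with their edge sets, i.e. as subgraphs)
  Unicyclic : Set
  Unicyclic = Σ Cycle λ C → ∀ (C′ : Cycle) → ∀ u v → CycEdge C′ u v ⇔ CycEdge C u v

  Independent : Subset n → Set
  Independent S = ∀ u v → u ∈ S → v ∈ S → ¬ Adj G u v

  IsAlpha : ℕ → Set
  IsAlpha a = (∃[ S ] (Independent S × ∣ S ∣ ≡ a))
            × (∀ S → Independent S → ∣ S ∣ ≤ a)

  endpoints : List (Fin n × Fin n) → List (Fin n)
  endpoints = concatMap (λ e → Data.Product.proj₁ e ∷ Data.Product.proj₂ e ∷ [])

  IsMatching : List (Fin n × Fin n) → Set
  IsMatching M = All (uncurry (Adj G)) M × Unique (endpoints M)

  IsMu : ℕ → Set
  IsMu m = (∃[ M ] (IsMatching M × length M ≡ m))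
         × (∀ M → IsMatching M → length M ≤ m)

  KonigEgervary : Set
  KonigEgervary = ∃[ a ] ∃[ m ] (IsAlpha a × IsMu m × a + m ≡ n)

  N : Subset n → Fin n → Set
  N X v = ∃[ w ] (w ∈ X × Adj G w v)

  HasCard : (Fin n → Set) → ℕ → Set
  HasCard P k = ∃[ S ] ((∀ v → v ∈ S ⇔ P v) × ∣ S ∣ ≡ k)

  IsD : Subset n → ℤ → Set
  IsD X d = ∃[ k ] (HasCard (N X) k × d ≡ (+ ∣ X ∣) ℤ.- (+ k))

  IsDc : ℤ → Set
  IsDc d = (∃[ X ] IsD X d) × (∀ X e → IsD X e → e ℤ.≤ d)

-- The procedure.  Vertices are labelled 0,1,2,… in order of creation;
-- a configuration is (number of vertices, edge list, colouring).

data Colour : Set where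
  blue red black : Colour

set : (ℕ → Colour) → ℕ → Colour → (ℕ → Colour)
set c x col y with y ≟ x
... | yes _ = col
... | no  _ = c y

oddCycleEdges : ℕ → List (ℕ × ℕ)
oddCycleEdges k = map (λ i → (i , suc i)) (upTo (2 + 2 ℕ.* k)) ++ [ (2 + 2 ℕ.* k , 0) ]

data Produces : (n : ℕ) → List (ℕ × ℕ) → (ℕ → Colour) → Set where
  start : (k : ℕ) → Produces (3 + 2 ℕ.* k) (oddCycleEdges k) (λ _ → blue)
  -- step (3): new u₁ = n (red), u₂ = n+1 (black), edges u u₁, u₁ u₂
  step3 : ∀ {n E c} → Produces n E c → (u : ℕ) → u < n →
          Produces (2 + n) ((u , n) ∷ (n , suc n) ∷ E) (set (set c n red) (suc n) black)
  -- step (4): u red, new u₁ = n (black), edge u u₁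
  step4 : ∀ {n E c} → Produces n E c → (u : ℕ) → u < n → c u ≡ red →
          Produces (suc n) ((u , n) ∷ E) (set c n black)

PAdj : List (ℕ × ℕ) → ℕ → ℕ → Set
PAdj E i j = (i , j) L.∈ E ⊎ (j , i) L.∈ E

-- G is isomorphic to the produced graph via σ (σ maps procedure labels to vertices of G)
IsoTo : ∀ {n} → Graph n → List (ℕ × ℕ) → Fin n ↔ Fin n → Set
IsoTo G E σ = ∀ i j → Adj G (Inverse.to σ i) (Inverse.to σ j) ⇔ PAdj E (toℕ i) (toℕ j)

isCol : Colour → Colour → Bool
isCol blue  blue  = true
isCol red   red   = true
isCol black black = true
isCol _     _     = false

colourClass : ∀ {n} → Fin n ↔ Fin n → (ℕ → Colour) → Colour → Subset n
colourClass σ c col = tabulate (λ v → isCol col (c (toℕ (Inverse.from σ v))))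

-- Let the odd cycle C have 2k + 3 (blue) vertices.  Every red vertex has a
-- black mate, the neighbour created together with it, and every edge off C has a
-- red end.  Give each black vertex two tokens and each vertex of C one.  An
-- independent set charges two tokens per vertex: a blue vertex the tokens of
-- itself and of its successor on C, any other vertex both tokens of the black
-- vertex of its pendant pair.  Independence makes these charges disjoint, so
-- 2α ≤ 2|B| + 2k + 3, i.e. α ≤ |B| + k + 1.  Likewise, with two tokens per red
-- vertex, a matching charges each edge to both tokens of a red end or to the
-- tokens of its two (blue) ends, so μ ≤ |R| + k + 1.  Both bounds are attained:
-- by B together with the vertices 0, 2, …, 2k of C, and by the pendant edges
-- together with the cycle edges {2j, 2j + 1}.  Finally N(B) = R, while for any X,
-- sending a vertex of X to its successor on C or to its mate (or to itself in B
-- when it is its own mate) and a red vertex to its mate injects X ⊎ R into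
-- N(X) ⊎ B, so d(X) ≤ |B| − |R|.

module Submission where

open import Defs hiding (sym)
open import Data.Bool using (Bool; true; false)
open import Data.Empty using (⊥; ⊥-elim)
open import Data.Fin as Fin using (Fin; toℕ; fromℕ<)
import Data.Fin.Properties as FinP
open import Data.Fin.Subset using (Subset; _∈_; ∣_∣; ⁅_⁆; _∪_) renaming (⊥ to ⊥ₛ)
import Data.Fin.Subset.Properties as SubsetP
open import Data.Integer as ℤ using (ℤ; +_; _-_; _⊖_)
import Data.Integer.Properties as ℤP
open import Data.List using (List; []; _∷_; _++_; map; length; concatMap; upTo)
open import Data.List.Membership.Propositional using (find) renaming (_∈_ to _∈ₗ_)
open import Data.List.Membership.Propositional.Properties
  using (∈-map⁺; ∈-map⁻; ∈-++⁺ˡ; ∈-++⁺ʳ; ∈-++⁻; ∈-concat⁺′; ∈-concatMap⁻; ∈-upTo⁺; ∈-upTo⁻)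
open import Data.List.Properties using (length-map; length-++; length-upTo; concatMap-++; concatMap-map)
open import Data.List.Relation.Unary.All as All using (All)
open import Data.List.Relation.Unary.Any using (here; there)
open import Data.List.Relation.Unary.Unique.Propositional using (Unique; []; _∷_)
import Data.List.Relation.Unary.Unique.Propositional.Properties as Unique
open import Data.Nat using (ℕ; suc; _+_; _*_; _≤_; _<_; z≤n; s≤s; _≟_; _<?_)
import Data.Nat.Properties as ℕP
open import Data.Nat.Tactic.RingSolver using (solve-∀)
open import Data.Product using (_×_; _,_; ∃-syntax; proj₁; proj₂; uncurry)
open import Data.Product.Properties using (,-injectiveˡ; ,-injectiveʳ)
open import Data.Sum using (_⊎_; inj₁; inj₂)
open import Data.Vec as Vec using ([]; _∷_)
import Data.Vec.Properties as VecP
open import Function using (case_of_; _∘_)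
open import Function.Bundles using (_↔_; _⇔_; Inverse; Equivalence; mk⇔)
open import Relation.Binary.PropositionalEquality
open import Relation.Nullary using (¬_; Dec; yes; no)

private variable n : ℕ

module _ {a} {A : Set a} where

  private
    remove : ∀ {x : A} ys → x ∈ₗ ys → List A
    remove (_ ∷ ys) (here _)  = ys
    remove (y ∷ ys) (there p) = y ∷ remove ys p

    length-remove : ∀ {x} ys (p : x ∈ₗ ys) → suc (length (remove ys p)) ≡ length ys
    length-remove (_ ∷ _)  (here _)  = refl
    length-remove (_ ∷ ys) (there p) = cong suc (length-remove ys p)

    ∈-remove : ∀ {x z} ys (p : x ∈ₗ ys) → z ∈ₗ ys → z ≢ x → z ∈ₗ remove ys p
    ∈-remove (_ ∷ _)  (here refl) (here refl) z≢x = ⊥-elim (z≢x refl)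
    ∈-remove (_ ∷ _)  (here refl) (there q)   _   = q
    ∈-remove (_ ∷ _)  (there p)   (here refl) _   = here refl
    ∈-remove (_ ∷ ys) (there p)   (there q)   z≢x = there (∈-remove ys p q z≢x)

  Unique∧⊆⇒length≤ : ∀ {xs ys : List A} → Unique xs → (∀ {z} → z ∈ₗ xs → z ∈ₗ ys) →
                     length xs ≤ length ys
  Unique∧⊆⇒length≤ {[]}     _          _   = z≤n
  Unique∧⊆⇒length≤ {x ∷ xs} {ys} (x∉ ∷ u) xs⊆ys = subst (_ ≤_) (length-remove ys x∈ys)
    (s≤s (Unique∧⊆⇒length≤ u λ z∈xs →
      ∈-remove ys x∈ys (xs⊆ys (there z∈xs)) λ z≡x → All.lookup x∉ z∈xs (sym z≡x)))
    where x∈ys = xs⊆ys (here refl)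

  Unique-pair : ∀ {x y : A} → x ≢ y → Unique (x ∷ y ∷ [])
  Unique-pair x≢y = (x≢y All.∷ All.[]) ∷ All.[] ∷ []

  Unique-++⁻ : ∀ xs {ys : List A} → Unique (xs ++ ys) →
               Unique xs × Unique ys × (∀ {z} → z ∈ₗ xs → z ∈ₗ ys → ⊥)
  Unique-++⁻ []       u          = [] , u , λ ()
  Unique-++⁻ (x ∷ xs) (x∉ ∷ u) with Unique-++⁻ xs u
  ... | uxs , uys , disjoint =
    All.tabulate (λ z∈xs → All.lookup x∉ (∈-++⁺ˡ z∈xs)) ∷ uxs , uys ,
    λ { (here refl) z∈ys → All.lookup x∉ (∈-++⁺ʳ xs z∈ys) refl
      ; (there z∈xs) z∈ys → disjoint z∈xs z∈ys }

  Unique-map-local : ∀ {b} {B : Set b} (f : A → B) {xs} → Unique xs →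
                     (∀ {x y} → x ∈ₗ xs → y ∈ₗ xs → f x ≡ f y → x ≡ y) → Unique (map f xs)
  Unique-map-local f {[]}     _        _   = []
  Unique-map-local f {x ∷ xs} (x∉ ∷ u) inj =
    All.tabulate fx∉ ∷ Unique-map-local f u λ p q → inj (there p) (there q)
    where
    fx∉ : ∀ {z} → z ∈ₗ map f xs → f x ≢ z
    fx∉ z∈ fx≡z with ∈-map⁻ f z∈
    ... | y , y∈xs , refl = All.lookup x∉ y∈xs (inj (here refl) (there y∈xs) fx≡z)

module _ {a b} {A : Set a} {B : Set b} (ψ : A → List B) where

  length-concatMap-const : ∀ k xs → (∀ {x} → x ∈ₗ xs → length (ψ x) ≡ k) →
                           length (concatMap ψ xs) ≡ k * length xs
  length-concatMap-const k []       _   = sym (ℕP.*-zeroʳ k)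
  length-concatMap-const k (x ∷ xs) len = begin
    length (ψ x ++ concatMap ψ xs)         ≡⟨ length-++ (ψ x) ⟩
    length (ψ x) + length (concatMap ψ xs) ≡⟨ cong₂ _+_ (len (here refl))
                                                (length-concatMap-const k xs (λ p → len (there p))) ⟩
    k + k * length xs                      ≡⟨ sym (ℕP.*-suc k (length xs)) ⟩
    k * suc (length xs)                    ∎
    where open ≡-Reasoning

  ∈-concatMap⁻′ : ∀ {b} xs → b ∈ₗ concatMap ψ xs → ∃[ x ] (x ∈ₗ xs × b ∈ₗ ψ x)
  ∈-concatMap⁻′ xs b∈ = find (∈-concatMap⁻ ψ {xs = xs} b∈)

  concatMap-Unique : ∀ {xs} → Unique xs → (∀ {x} → x ∈ₗ xs → Unique (ψ x)) →
                     (∀ {x y b} → x ∈ₗ xs → y ∈ₗ xs → b ∈ₗ ψ x → b ∈ₗ ψ y → x ≡ y) →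
                     Unique (concatMap ψ xs)
  concatMap-Unique {[]}     _        _       _     = []
  concatMap-Unique {x ∷ xs} (x∉ ∷ u) uniqueψ owner =
    Unique.++⁺ (uniqueψ (here refl))
               (concatMap-Unique u (λ p → uniqueψ (there p)) λ p q → owner (there p) (there q))
               λ (b∈ψx , b∈rest) → let y , y∈xs , b∈ψy = ∈-concatMap⁻′ xs b∈rest in
                 All.lookup x∉ y∈xs (owner (here refl) (there y∈xs) b∈ψx b∈ψy)

  concatMap-Unique-along : ∀ {c} {C : Set c} (φ : A → List C) (f : B → C) →
                           (∀ x {b} → b ∈ₗ ψ x → f b ∈ₗ φ x) →
                           ∀ xs → (∀ {x} → x ∈ₗ xs → Unique (ψ x)) →
                           Unique (concatMap φ xs) → Unique (concatMap ψ xs)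
  concatMap-Unique-along φ f f∈φ []       _       _ = []
  concatMap-Unique-along φ f f∈φ (x ∷ xs) uniqueψ u with Unique-++⁻ (φ x) u
  ... | _ , u-rest , disjoint =
    Unique.++⁺ (uniqueψ (here refl))
               (concatMap-Unique-along φ f f∈φ xs (λ p → uniqueψ (there p)) u-rest)
      λ (b∈ψx , b∈rest) → let y , y∈xs , b∈ψy = ∈-concatMap⁻′ xs b∈rest in
        disjoint (f∈φ x b∈ψx) (∈-concat⁺′ (f∈φ y b∈ψy) (∈-map⁺ φ y∈xs))


elements : Subset n → List (Fin n)
elements []          = []
elements (true ∷ p)  = Fin.zero ∷ map Fin.suc (elements p)
elements (false ∷ p) = map Fin.suc (elements p)

length-elements : (p : Subset n) → length (elements p) ≡ ∣ p ∣
length-elements []          = refl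
length-elements (true ∷ p)  = cong suc (trans (length-map Fin.suc (elements p)) (length-elements p))
length-elements (false ∷ p) = trans (length-map Fin.suc (elements p)) (length-elements p)

elements-Unique : (p : Subset n) → Unique (elements p)
elements-Unique []          = []
elements-Unique (true ∷ p)  =
  All.tabulate zero∉ ∷ Unique.map⁺ FinP.suc-injective (elements-Unique p)
  where
  zero∉ : ∀ {x} → x ∈ₗ map Fin.suc (elements p) → Fin.zero ≢ x
  zero∉ x∈ with ∈-map⁻ Fin.suc x∈
  zero∉ x∈ | _ , _ , refl = λ ()
elements-Unique (false ∷ p) = Unique.map⁺ FinP.suc-injective (elements-Unique p)

∈-elements⁺ : ∀ {x} (p : Subset n) → x ∈ p → x ∈ₗ elements p
∈-elements⁺ (true ∷ p)  Vec.here       = here refl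
∈-elements⁺ (true ∷ p)  (Vec.there x∈) = there (∈-map⁺ Fin.suc (∈-elements⁺ p x∈))
∈-elements⁺ (false ∷ p) (Vec.there x∈) = ∈-map⁺ Fin.suc (∈-elements⁺ p x∈)

∈-elements⁻ : ∀ {x} (p : Subset n) → x ∈ₗ elements p → x ∈ p
∈-elements⁻ (true ∷ p)  (here refl) = Vec.here
∈-elements⁻ (true ∷ p)  (there x∈) with ∈-map⁻ Fin.suc x∈
... | _ , y∈ , refl = Vec.there (∈-elements⁻ p y∈)
∈-elements⁻ (false ∷ p) x∈ with ∈-map⁻ Fin.suc x∈
... | _ , y∈ , refl = Vec.there (∈-elements⁻ p y∈)

fromList : List (Fin n) → Subset n
fromList []       = ⊥ₛ
fromList (x ∷ xs) = ⁅ x ⁆ ∪ fromList xs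

∈-fromList⁺ : ∀ {x : Fin n} {xs} → x ∈ₗ xs → x ∈ fromList xs
∈-fromList⁺ {x = x} (here refl) = SubsetP.x∈p∪q⁺ (inj₁ (SubsetP.x∈⁅x⁆ x))
∈-fromList⁺             (there x∈)  = SubsetP.x∈p∪q⁺ (inj₂ (∈-fromList⁺ x∈))

∈-fromList⁻ : ∀ {x : Fin n} xs → x ∈ fromList xs → x ∈ₗ xs
∈-fromList⁻ []       x∈ = ⊥-elim (SubsetP.∉⊥ x∈)
∈-fromList⁻ (y ∷ xs) x∈ with SubsetP.x∈p∪q⁻ ⁅ y ⁆ (fromList xs) x∈
... | inj₁ x∈⁅y⁆ = here (SubsetP.x∈⁅y⁆⇒x≡y y x∈⁅y⁆)
... | inj₂ x∈xs  = there (∈-fromList⁻ xs x∈xs)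

Unique⇒length≤∣fromList∣ : ∀ {xs : List (Fin n)} → Unique xs → length xs ≤ ∣ fromList xs ∣
Unique⇒length≤∣fromList∣ {xs = xs} u = subst (length xs ≤_) (length-elements (fromList xs))
  (Unique∧⊆⇒length≤ u λ x∈ → ∈-elements⁺ (fromList xs) (∈-fromList⁺ x∈))

∈-tabulate⁺ : ∀ {f : Fin n → Bool} {x} → f x ≡ true → x ∈ Vec.tabulate f
∈-tabulate⁺ {f = f} {x = x} fx = VecP.lookup⇒[]= x _ (trans (VecP.lookup∘tabulate f x) fx)

∈-tabulate⁻ : ∀ {f : Fin n → Bool} {x} → x ∈ Vec.tabulate f → f x ≡ true
∈-tabulate⁻ {f = f} {x = x} x∈ = trans (sym (VecP.lookup∘tabulate f x)) (VecP.[]=⇒lookup x∈)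

-- Counting tokens

copy : Bool → Subset n → List (Fin n × Bool)
copy t p = map (_, t) (elements p)

length-copy : ∀ t (p : Subset n) → length (copy t p) ≡ ∣ p ∣
length-copy t p = trans (length-map (_, t) (elements p)) (length-elements p)

∈-copy⁺ : ∀ {t x} (p : Subset n) → x ∈ p → (x , t) ∈ₗ copy t p
∈-copy⁺ {t = t} p x∈p = ∈-map⁺ (_, t) (∈-elements⁺ p x∈p)

∈-copy⁻ : ∀ {t t′ x} (p : Subset n) → (x , t) ∈ₗ copy t′ p → x ∈ p × t ≡ t′
∈-copy⁻ {t′ = t′} p x∈ with ∈-map⁻ (_, t′) x∈
... | _ , x∈p , refl = ∈-elements⁻ p x∈p , refl

copy-Unique : ∀ t (p : Subset n) → Unique (copy t p)
copy-Unique t p = Unique.map⁺ ,-injectiveˡ (elements-Unique p)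

-- The disjoint union p ⊎ q: elements of p are tagged false, those of q true.
tagged : Subset n → Subset n → List (Fin n × Bool)
tagged p q = copy false p ++ copy true q

length-tagged : (p q : Subset n) → length (tagged p q) ≡ ∣ p ∣ + ∣ q ∣
length-tagged p q = trans (length-++ (copy false p)) (cong₂ _+_ (length-copy false p) (length-copy true q))

tagged-Unique : (p q : Subset n) → Unique (tagged p q)
tagged-Unique p q = Unique.++⁺ (copy-Unique false p) (copy-Unique true q) λ (t∈p , t∈q) →
  case trans (sym (proj₂ (∈-copy⁻ p t∈p))) (proj₂ (∈-copy⁻ q t∈q)) of λ ()

∈-taggedˡ⁺ : ∀ {x} (p q : Subset n) → x ∈ p → (x , false) ∈ₗ tagged p q
∈-taggedˡ⁺ p q x∈p = ∈-++⁺ˡ (∈-copy⁺ p x∈p)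

∈-taggedʳ⁺ : ∀ {x} (p q : Subset n) → x ∈ q → (x , true) ∈ₗ tagged p q
∈-taggedʳ⁺ p q x∈q = ∈-++⁺ʳ (copy false p) (∈-copy⁺ q x∈q)

∈-tagged⁻ : ∀ {x t} (p q : Subset n) → (x , t) ∈ₗ tagged p q → (t ≡ false × x ∈ p) ⊎ (t ≡ true × x ∈ q)
∈-tagged⁻ p q x∈ with ∈-++⁻ (copy false p) x∈
... | inj₁ x∈p = let x∈ , t≡ = ∈-copy⁻ p x∈p in inj₁ (t≡ , x∈)
... | inj₂ x∈q = let x∈ , t≡ = ∈-copy⁻ q x∈q in inj₂ (t≡ , x∈)

tokens : Subset n → Subset n → List (Fin n × Bool)
tokens p q = tagged p p ++ copy false q

length-tokens : (p q : Subset n) → length (tokens p q) ≡ (∣ p ∣ + ∣ p ∣) + ∣ q ∣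
length-tokens p q = trans (length-++ (tagged p p)) (cong₂ _+_ (length-tagged p p) (length-copy false q))

data Charge (p q : Subset n) : List (Fin n × Bool) → Set where
  double : ∀ {v} → v ∈ p → Charge p q ((v , false) ∷ (v , true) ∷ [])
  pair   : ∀ {v w} → v ∈ q → w ∈ q → v ≢ w → Charge p q ((v , false) ∷ (w , false) ∷ [])

module _ {p q : Subset n} where

  length-Charge : ∀ {ts} → Charge p q ts → length ts ≡ 2
  length-Charge (double _)   = refl
  length-Charge (pair _ _ _) = refl

  Charge-Unique : ∀ {ts} → Charge p q ts → Unique ts
  Charge-Unique (double _)     = Unique-pair λ ()
  Charge-Unique (pair _ _ v≢w) = Unique-pair (v≢w ∘ ,-injectiveˡ)

  Charge⊆tokens : ∀ {ts t} → Charge p q ts → t ∈ₗ ts → t ∈ₗ tokens p q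
  Charge⊆tokens (double v∈p) (here refl) = ∈-++⁺ˡ (∈-++⁺ˡ (∈-copy⁺ p v∈p))
  Charge⊆tokens (double v∈p) (there (here refl)) = ∈-++⁺ˡ (∈-++⁺ʳ (copy false p) (∈-copy⁺ p v∈p))
  Charge⊆tokens (pair v∈q _ _) (here refl) = ∈-++⁺ʳ (tagged p p) (∈-copy⁺ q v∈q)
  Charge⊆tokens (pair _ w∈q _) (there (here refl)) = ∈-++⁺ʳ (tagged p p) (∈-copy⁺ q w∈q)

  charging : ∀ {a} {A : Set a} (ψ : A → List (Fin n × Bool)) xs → Unique (concatMap ψ xs) →
             (∀ {x} → x ∈ₗ xs → Charge p q (ψ x)) → 2 * length xs ≤ (∣ p ∣ + ∣ p ∣) + ∣ q ∣
  charging ψ xs u charge = subst₂ _≤_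
    (length-concatMap-const ψ 2 xs (λ x∈ → length-Charge (charge x∈)))
    (length-tokens p q)
    (Unique∧⊆⇒length≤ u λ t∈ → let x , x∈ , t∈ψx = ∈-concatMap⁻′ ψ xs t∈ in
                                 Charge⊆tokens (charge x∈) t∈ψx)

2*m≤1+2*n⇒m≤n : ∀ {m n} → 2 * m ≤ suc (2 * n) → m ≤ n
2*m≤1+2*n⇒m≤n {m} {n} le = ℕP.≤-pred (ℕP.*-cancelˡ-< 2 m (suc n)
  (subst (2 * m <_) (sym (ℕP.*-suc 2 n)) (s≤s le)))

charge-count : ∀ {m b c} k → 2 * m ≤ (b + b) + c → c ≤ 3 + 2 * k → m ≤ suc k + b
charge-count {m} {b} {c} k tokens c≤ = 2*m≤1+2*n⇒m≤n (begin
  2 * m                   ≤⟨ tokens ⟩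
  (b + b) + c             ≤⟨ ℕP.+-monoʳ-≤ (b + b) c≤ ⟩
  (b + b) + (3 + 2 * k)   ≡⟨ count b k ⟩
  suc (2 * (suc k + b))   ∎)
  where
  open ℕP.≤-Reasoning
  count : ∀ b k → (b + b) + (3 + 2 * k) ≡ suc (2 * (suc k + b))
  count = solve-∀

halves-equal : ∀ {i j j′} → i ≡ 2 * j ⊎ i ≡ suc (2 * j) → i ≡ 2 * j′ ⊎ i ≡ suc (2 * j′) → j ≡ j′
halves-equal {j = j} {j′} (inj₁ refl) (inj₁ eq) = ℕP.*-cancelˡ-≡ j j′ 2 eq
halves-equal {j = j} {j′} (inj₁ refl) (inj₂ eq) = ⊥-elim (ℕP.even≢odd j j′ eq)
halves-equal {j = j} {j′} (inj₂ refl) (inj₁ eq) = ⊥-elim (ℕP.even≢odd j′ j (sym eq))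
halves-equal {j = j} {j′} (inj₂ refl) (inj₂ eq) = ℕP.*-cancelˡ-≡ j j′ 2 (ℕP.suc-injective eq)

[+x]-[+k]≤[+b]-[+r] : ∀ x k b r → x + r ≤ k + b → + x - + k ℤ.≤ + b - + r
[+x]-[+k]≤[+b]-[+r] x k b r le = begin
  + x - + k         ≡⟨ ℤP.[+m]-[+n]≡m⊖n x k ⟩
  x ⊖ k             ≡⟨ ℤP.+-cancelˡ-⊖ r x k ⟨
  (r + x) ⊖ (r + k) ≤⟨ ℤP.⊖-monoˡ-≤ (r + k) (subst (_≤ k + b) (ℕP.+-comm x r) le) ⟩
  (k + b) ⊖ (r + k) ≡⟨ cong ((k + b) ⊖_) (ℕP.+-comm r k) ⟩
  (k + b) ⊖ (k + r) ≡⟨ ℤP.+-cancelˡ-⊖ k b r ⟩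
  b ⊖ r             ≡⟨ ℤP.[+m]-[+n]≡m⊖n b r ⟨
  + b - + r         ∎
  where open ℤP.≤-Reasoning

[+m+x]-[+m+y]≡[+x]-[+y] : ∀ m x y → + (m + x) - + (m + y) ≡ + x - + y
[+m+x]-[+m+y]≡[+x]-[+y] m x y = begin
  + (m + x) - + (m + y) ≡⟨ ℤP.[+m]-[+n]≡m⊖n (m + x) (m + y) ⟩
  (m + x) ⊖ (m + y)     ≡⟨ ℤP.+-cancelˡ-⊖ m x y ⟩
  x ⊖ y                 ≡⟨ ℤP.[+m]-[+n]≡m⊖n x y ⟨
  + x - + y             ∎
  where open ≡-Reasoning

module OddCycle (k : ℕ) where

  L : ℕ
  L = 3 + 2 * k

  private
    succ-edge : ℕ → ℕ × ℕ
    succ-edge i = i , suc i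

  ∈-oddCycleEdges⁻ : ∀ {i j} → (i , j) ∈ₗ oddCycleEdges k →
                     (suc i ≡ j × j < L) ⊎ (i ≡ 2 + 2 * k × j ≡ 0)
  ∈-oddCycleEdges⁻ e∈ with ∈-++⁻ (map succ-edge (upTo (2 + 2 * k))) e∈
  ... | inj₂ (here refl) = inj₂ (refl , refl)
  ... | inj₁ e∈succ with ∈-map⁻ succ-edge e∈succ
  ... | _ , i∈ , refl = inj₁ (refl , s≤s (∈-upTo⁻ i∈))

  succ-∈-oddCycleEdges : ∀ {i} → suc i < L → (i , suc i) ∈ₗ oddCycleEdges k
  succ-∈-oddCycleEdges (s≤s i<) = ∈-++⁺ˡ (∈-map⁺ succ-edge (∈-upTo⁺ i<))

  closing-∈-oddCycleEdges : (2 + 2 * k , 0) ∈ₗ oddCycleEdges k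
  closing-∈-oddCycleEdges = ∈-++⁺ʳ (map succ-edge (upTo (2 + 2 * k))) (here refl)

  CycleAdj : ℕ → ℕ → Set
  CycleAdj = PAdj (oddCycleEdges k)

  CycleAdj⇒< : ∀ {i j} → CycleAdj i j → i < L × j < L
  CycleAdj⇒< (inj₁ e∈) with ∈-oddCycleEdges⁻ e∈
  ... | inj₁ (refl , j<) = ℕP.<-trans (ℕP.n<1+n _) j< , j<
  ... | inj₂ (refl , refl) = ℕP.≤-refl , s≤s z≤n
  CycleAdj⇒< (inj₂ e∈) with ∈-oddCycleEdges⁻ e∈
  ... | inj₁ (refl , i<) = i< , ℕP.<-trans (ℕP.n<1+n _) i<
  ... | inj₂ (refl , refl) = s≤s z≤n , ℕP.≤-refl

  even<L : ∀ {i} → i ≤ k → 2 * i < L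
  even<L i≤k = s≤s (ℕP.≤-trans (ℕP.*-monoʳ-≤ 2 i≤k) (ℕP.m≤n+m _ 2))

  odd<L : ∀ {i} → i ≤ k → suc (2 * i) < L
  odd<L i≤k = s≤s (s≤s (ℕP.≤-trans (ℕP.*-monoʳ-≤ 2 i≤k) (ℕP.m≤n+m _ 1)))

  private
    even≢top : ∀ {i} → i ≤ k → 2 * i ≢ 2 + 2 * k
    even≢top i≤k = ℕP.<⇒≢ (s≤s (ℕP.m≤n⇒m≤1+n (ℕP.*-monoʳ-≤ 2 i≤k)))

  even-nonadjacent : ∀ {i j} → i ≤ k → j ≤ k → ¬ CycleAdj (2 * i) (2 * j)
  even-nonadjacent {i} {j} i≤k j≤k (inj₁ e∈) with ∈-oddCycleEdges⁻ e∈
  ... | inj₁ (odd≡even , _) = ℕP.even≢odd j i (sym odd≡even)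
  ... | inj₂ (top , _)      = even≢top i≤k top
  even-nonadjacent {i} {j} i≤k j≤k (inj₂ e∈) with ∈-oddCycleEdges⁻ e∈
  ... | inj₁ (odd≡even , _) = ℕP.even≢odd i j (sym odd≡even)
  ... | inj₂ (top , _)      = even≢top j≤k top

  next : ℕ → ℕ
  next i with i ≟ 2 + 2 * k
  ... | yes _ = 0
  ... | no  _ = suc i

  next< : ∀ {i} → i < L → next i < L
  next< {i} i< with i ≟ 2 + 2 * k | ℕP.m<1+n⇒m<n∨m≡n i<
  ... | yes _     | _          = s≤s z≤n
  ... | no  _     | inj₁ i<top = s≤s i<top
  ... | no  i≢top | inj₂ i≡top = ⊥-elim (i≢top i≡top)

  next-adjacent : ∀ {i} → i < L → CycleAdj i (next i)
  next-adjacent {i} i< with i ≟ 2 + 2 * k | ℕP.m<1+n⇒m<n∨m≡n i<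
  ... | yes refl  | _          = inj₁ closing-∈-oddCycleEdges
  ... | no  _     | inj₁ i<top = inj₁ (succ-∈-oddCycleEdges (s≤s i<top))
  ... | no  i≢top | inj₂ i≡top = ⊥-elim (i≢top i≡top)

  next-injective : ∀ {i j} → next i ≡ next j → i ≡ j
  next-injective {i} {j} eq with i ≟ 2 + 2 * k | j ≟ 2 + 2 * k | eq
  ... | yes i≡top | yes j≡top | _   = trans i≡top (sym j≡top)
  ... | no  _     | no  _     | eq′ = ℕP.suc-injective eq′

  next≢ : ∀ i → next i ≢ i
  next≢ i with i ≟ 2 + 2 * k
  ... | yes i≡top = λ 0≡i → case trans 0≡i i≡top of λ ()
  ... | no  _     = ℕP.1+n≢n

-- mate pairs every red vertex with the black vertex created with it in step (3)
-- and fixes the black leaves added in step (4).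
record Invariant (n : ℕ) (E : List (ℕ × ℕ)) (c : ℕ → Colour) : Set where
  field
    k                 : ℕ
    mate              : ℕ → ℕ
  open OddCycle k public
  field
    L≤n               : L ≤ n
    blue⇒<L           : ∀ {i} → i < n → c i ≡ blue → i < L
    <L⇒blue           : ∀ {i} → i < L → c i ≡ blue
    mate<             : ∀ {i} → i < n → mate i < n
    mate-involutive   : ∀ {i} → i < n → mate (mate i) ≡ i
    red-mate          : ∀ {i} → i < n → c i ≡ red → c (mate i) ≡ black × PAdj E i (mate i)
    black-mate        : ∀ {i} → i < n → c i ≡ black → mate i ≡ i ⊎ c (mate i) ≡ red
    edge<             : ∀ {i j} → PAdj E i j → i < n × j < n
    edge-red-or-cycle : ∀ {i j} → PAdj E i j → c i ≡ red ⊎ c j ≡ red ⊎ CycleAdj i j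
    cycle⊆            : ∀ {e} → e ∈ₗ oddCycleEdges k → e ∈ₗ E

update : ∀ {a} {A : Set a} → (ℕ → A) → ℕ → A → ℕ → A
update f x v y with y ≟ x
... | yes _ = v
... | no  _ = f y

module _ {a} {A : Set a} (f : ℕ → A) (x : ℕ) (v : A) where

  update-same : update f x v x ≡ v
  update-same with x ≟ x
  ... | yes _   = refl
  ... | no  x≢x = ⊥-elim (x≢x refl)

  update-other : ∀ {y} → y ≢ x → update f x v y ≡ f y
  update-other {y} y≢x with y ≟ x
  ... | yes y≡x = ⊥-elim (y≢x y≡x)
  ... | no  _   = refl

module _ (c : ℕ → Colour) (x : ℕ) (col : Colour) where

  set-same : set c x col x ≡ col
  set-same with x ≟ x
  ... | yes _   = refl
  ... | no  x≢x = ⊥-elim (x≢x refl)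

  set-other : ∀ {y} → y ≢ x → set c x col y ≡ c y
  set-other {y} y≢x with y ≟ x
  ... | yes y≡x = ⊥-elim (y≢x y≡x)
  ... | no  _   = refl

PAdj-∷⁺ : ∀ {e E i j} → PAdj E i j → PAdj (e ∷ E) i j
PAdj-∷⁺ (inj₁ p) = inj₁ (there p)
PAdj-∷⁺ (inj₂ p) = inj₂ (there p)

PAdj-∷⁻ : ∀ {e E i j} → PAdj (e ∷ E) i j → (i , j) ≡ e ⊎ (j , i) ≡ e ⊎ PAdj E i j
PAdj-∷⁻ (inj₁ (here e≡))  = inj₁ e≡
PAdj-∷⁻ (inj₂ (here e≡))  = inj₂ (inj₁ e≡)
PAdj-∷⁻ (inj₁ (there p))  = inj₂ (inj₂ (inj₁ p))
PAdj-∷⁻ (inj₂ (there p))  = inj₂ (inj₂ (inj₂ p))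

data Fresh₁ (n : ℕ) : ℕ → Set where
  old : ∀ {i} → i < n → Fresh₁ n i
  new : Fresh₁ n n

fresh₁ : ∀ {n i} → i < suc n → Fresh₁ n i
fresh₁ i< with ℕP.m<1+n⇒m<n∨m≡n i<
... | inj₁ i<n  = old i<n
... | inj₂ refl = new

data Fresh₂ (n : ℕ) : ℕ → Set where
  old  : ∀ {i} → i < n → Fresh₂ n i
  new₁ : Fresh₂ n n
  new₂ : Fresh₂ n (suc n)

fresh₂ : ∀ {n i} → i < 2 + n → Fresh₂ n i
fresh₂ i< with fresh₁ i<
... | new = new₂
... | old i<1+n with fresh₁ i<1+n
...   | old i<n = old i<n
...   | new     = new₁

red-or-cycle-mono : ∀ {n k} {c c′ : ℕ → Colour} → (∀ {i} → i < n → c′ i ≡ c i) →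
                    ∀ {i j} → i < n → j < n → c i ≡ red ⊎ c j ≡ red ⊎ OddCycle.CycleAdj k i j →
                    c′ i ≡ red ⊎ c′ j ≡ red ⊎ OddCycle.CycleAdj k i j
red-or-cycle-mono agree i<n j<n (inj₁ ci)        = inj₁ (trans (agree i<n) ci)
red-or-cycle-mono agree i<n j<n (inj₂ (inj₁ cj)) = inj₂ (inj₁ (trans (agree j<n) cj))
red-or-cycle-mono agree i<n j<n (inj₂ (inj₂ a))  = inj₂ (inj₂ a)

invariant-start : ∀ k → Invariant (3 + 2 * k) (oddCycleEdges k) (λ _ → blue)
invariant-start k = record
  { k = k ; mate = λ i → i ; L≤n = ℕP.≤-refl
  ; blue⇒<L = λ i< _ → i< ; <L⇒blue = λ _ → refl
  ; mate< = λ i< → i< ; mate-involutive = λ _ → refl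
  ; red-mate = λ _ () ; black-mate = λ _ ()
  ; edge< = OddCycle.CycleAdj⇒< k ; edge-red-or-cycle = λ a → inj₂ (inj₂ a)
  ; cycle⊆ = λ e∈ → e∈ }

module Step3 {n E c} (I : Invariant n E c) (u : ℕ) (u<n : u < n) where
  open Invariant I

  c′ : ℕ → Colour
  c′ = set (set c n red) (suc n) black

  mate′ : ℕ → ℕ
  mate′ = update (update mate (suc n) n) n (suc n)

  E′ : List (ℕ × ℕ)
  E′ = (u , n) ∷ (n , suc n) ∷ E

  private
    n≢1+n : n ≢ suc n
    n≢1+n = ℕP.<⇒≢ (ℕP.n<1+n n)

    lift : ∀ {i} → i < n → i < 2 + n
    lift i<n = ℕP.m<n⇒m<1+n (ℕP.m<n⇒m<1+n i<n)

    n<2+n : n < 2 + n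
    n<2+n = ℕP.m<n⇒m<1+n (ℕP.n<1+n n)

    1+n<2+n : suc n < 2 + n
    1+n<2+n = ℕP.n<1+n (suc n)

  c′-old : ∀ {i} → i < n → c′ i ≡ c i
  c′-old i<n = trans (set-other _ (suc n) black (ℕP.<⇒≢ (ℕP.m<n⇒m<1+n i<n)))
                     (set-other c n red (ℕP.<⇒≢ i<n))

  c′-new₁ : c′ n ≡ red
  c′-new₁ = trans (set-other _ (suc n) black n≢1+n) (set-same c n red)

  c′-new₂ : c′ (suc n) ≡ black
  c′-new₂ = set-same _ (suc n) black

  mate′-old : ∀ {i} → i < n → mate′ i ≡ mate i
  mate′-old i<n = trans (update-other _ n (suc n) (ℕP.<⇒≢ i<n))
                        (update-other mate (suc n) n (ℕP.<⇒≢ (ℕP.m<n⇒m<1+n i<n)))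

  mate′-new₁ : mate′ n ≡ suc n
  mate′-new₁ = update-same _ n (suc n)

  mate′-new₂ : mate′ (suc n) ≡ n
  mate′-new₂ = trans (update-other _ n (suc n) (n≢1+n ∘ sym)) (update-same mate (suc n) n)

  blue⇒<L′ : ∀ {i} → i < 2 + n → c′ i ≡ blue → i < L
  blue⇒<L′ i< blue′ with fresh₂ i<
  ... | old i<n = blue⇒<L i<n (trans (sym (c′-old i<n)) blue′)
  ... | new₁    = case trans (sym c′-new₁) blue′ of λ ()
  ... | new₂    = case trans (sym c′-new₂) blue′ of λ ()

  mate<′ : ∀ {i} → i < 2 + n → mate′ i < 2 + n
  mate<′ i< with fresh₂ i<
  ... | old i<n = subst (_< 2 + n) (sym (mate′-old i<n)) (lift (mate< i<n))
  ... | new₁    = subst (_< 2 + n) (sym mate′-new₁) 1+n<2+n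
  ... | new₂    = subst (_< 2 + n) (sym mate′-new₂) n<2+n

  mate′-involutive : ∀ {i} → i < 2 + n → mate′ (mate′ i) ≡ i
  mate′-involutive i< with fresh₂ i<
  ... | old i<n = trans (cong mate′ (mate′-old i<n))
                        (trans (mate′-old (mate< i<n)) (mate-involutive i<n))
  ... | new₁    = trans (cong mate′ mate′-new₁) mate′-new₂
  ... | new₂    = trans (cong mate′ mate′-new₂) mate′-new₁

  red-mate′ : ∀ {i} → i < 2 + n → c′ i ≡ red → c′ (mate′ i) ≡ black × PAdj E′ i (mate′ i)
  red-mate′ i< red′ with fresh₂ i<
  ... | new₁    rewrite mate′-new₁ = c′-new₂ , inj₁ (there (here refl))
  ... | new₂    = case trans (sym c′-new₂) red′ of λ ()
  ... | old i<n with red-mate i<n (trans (sym (c′-old i<n)) red′)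
  ...   | mate-black , adj rewrite mate′-old i<n =
    trans (c′-old (mate< i<n)) mate-black , PAdj-∷⁺ (PAdj-∷⁺ adj)

  black-mate′ : ∀ {i} → i < 2 + n → c′ i ≡ black → mate′ i ≡ i ⊎ c′ (mate′ i) ≡ red
  black-mate′ i< black′ with fresh₂ i<
  ... | new₁    = case trans (sym c′-new₁) black′ of λ ()
  ... | new₂    rewrite mate′-new₂ = inj₂ c′-new₁
  ... | old i<n rewrite mate′-old i<n | c′-old (mate< i<n) =
    black-mate i<n (trans (sym (c′-old i<n)) black′)

  edge<′ : ∀ {i j} → PAdj E′ i j → i < 2 + n × j < 2 + n
  edge<′ a with PAdj-∷⁻ a
  ... | inj₁ refl        = lift u<n , n<2+n
  ... | inj₂ (inj₁ refl) = n<2+n , lift u<n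
  ... | inj₂ (inj₂ a′) with PAdj-∷⁻ a′
  ...   | inj₁ refl        = n<2+n , 1+n<2+n
  ...   | inj₂ (inj₁ refl) = 1+n<2+n , n<2+n
  ...   | inj₂ (inj₂ a″)   = let i<n , j<n = edge< a″ in lift i<n , lift j<n

  edge-red-or-cycle′ : ∀ {i j} → PAdj E′ i j → c′ i ≡ red ⊎ c′ j ≡ red ⊎ CycleAdj i j
  edge-red-or-cycle′ a with PAdj-∷⁻ a
  ... | inj₁ refl        = inj₂ (inj₁ c′-new₁)
  ... | inj₂ (inj₁ refl) = inj₁ c′-new₁
  ... | inj₂ (inj₂ a′) with PAdj-∷⁻ a′
  ...   | inj₁ refl        = inj₁ c′-new₁
  ...   | inj₂ (inj₁ refl) = inj₂ (inj₁ c′-new₁)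
  ...   | inj₂ (inj₂ a″)   = let i<n , j<n = edge< a″ in
                             red-or-cycle-mono {k = k} c′-old i<n j<n (edge-red-or-cycle a″)

  invariant : Invariant (2 + n) E′ c′
  invariant = record
    { k = k ; mate = mate′ ; L≤n = ℕP.≤-trans L≤n (ℕP.m≤n+m n 2)
    ; blue⇒<L = blue⇒<L′ ; <L⇒blue = λ i<L → trans (c′-old (ℕP.<-≤-trans i<L L≤n)) (<L⇒blue i<L)
    ; mate< = mate<′ ; mate-involutive = mate′-involutive
    ; red-mate = red-mate′ ; black-mate = black-mate′
    ; edge< = edge<′ ; edge-red-or-cycle = edge-red-or-cycle′
    ; cycle⊆ = λ e∈ → there (there (cycle⊆ e∈)) }

module Step4 {n E c} (I : Invariant n E c) (u : ℕ) (u<n : u < n) (u-red : c u ≡ red) where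
  open Invariant I

  c′ : ℕ → Colour
  c′ = set c n black

  mate′ : ℕ → ℕ
  mate′ = update mate n n

  c′-old : ∀ {i} → i < n → c′ i ≡ c i
  c′-old i<n = set-other c n black (ℕP.<⇒≢ i<n)

  mate′-old : ∀ {i} → i < n → mate′ i ≡ mate i
  mate′-old i<n = update-other mate n n (ℕP.<⇒≢ i<n)

  mate′-new : mate′ n ≡ n
  mate′-new = update-same mate n n

  lift : ∀ {i} → i < n → i < suc n
  lift = ℕP.m<n⇒m<1+n

  blue⇒<L′ : ∀ {i} → i < suc n → c′ i ≡ blue → i < L
  blue⇒<L′ i< blue′ with fresh₁ i<
  ... | old i<n = blue⇒<L i<n (trans (sym (c′-old i<n)) blue′)
  ... | new     = case trans (sym (set-same c n black)) blue′ of λ ()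

  mate<′ : ∀ {i} → i < suc n → mate′ i < suc n
  mate<′ i< with fresh₁ i<
  ... | old i<n = subst (_< suc n) (sym (mate′-old i<n)) (lift (mate< i<n))
  ... | new     = subst (_< suc n) (sym mate′-new) (ℕP.n<1+n n)

  mate′-involutive : ∀ {i} → i < suc n → mate′ (mate′ i) ≡ i
  mate′-involutive i< with fresh₁ i<
  ... | old i<n = trans (cong mate′ (mate′-old i<n))
                        (trans (mate′-old (mate< i<n)) (mate-involutive i<n))
  ... | new     = trans (cong mate′ mate′-new) mate′-new

  red-mate′ : ∀ {i} → i < suc n → c′ i ≡ red → c′ (mate′ i) ≡ black × PAdj ((u , n) ∷ E) i (mate′ i)
  red-mate′ i< red′ with fresh₁ i<
  ... | new     = case trans (sym (set-same c n black)) red′ of λ ()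
  ... | old i<n with red-mate i<n (trans (sym (c′-old i<n)) red′)
  ...   | mate-black , adj rewrite mate′-old i<n = trans (c′-old (mate< i<n)) mate-black , PAdj-∷⁺ adj

  black-mate′ : ∀ {i} → i < suc n → c′ i ≡ black → mate′ i ≡ i ⊎ c′ (mate′ i) ≡ red
  black-mate′ i< black′ with fresh₁ i<
  ... | new     = inj₁ mate′-new
  ... | old i<n rewrite mate′-old i<n | c′-old (mate< i<n) =
    black-mate i<n (trans (sym (c′-old i<n)) black′)

  edge<′ : ∀ {i j} → PAdj ((u , n) ∷ E) i j → i < suc n × j < suc n
  edge<′ a with PAdj-∷⁻ a
  ... | inj₁ refl        = lift u<n , ℕP.n<1+n n
  ... | inj₂ (inj₁ refl) = ℕP.n<1+n n , lift u<n
  ... | inj₂ (inj₂ a′)   = let i<n , j<n = edge< a′ in lift i<n , lift j<n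

  edge-red-or-cycle′ : ∀ {i j} → PAdj ((u , n) ∷ E) i j → c′ i ≡ red ⊎ c′ j ≡ red ⊎ CycleAdj i j
  edge-red-or-cycle′ a with PAdj-∷⁻ a
  ... | inj₁ refl        = inj₁ (trans (c′-old u<n) u-red)
  ... | inj₂ (inj₁ refl) = inj₂ (inj₁ (trans (c′-old u<n) u-red))
  ... | inj₂ (inj₂ a′)   = let i<n , j<n = edge< a′ in
                           red-or-cycle-mono {k = k} c′-old i<n j<n (edge-red-or-cycle a′)

  invariant : Invariant (suc n) ((u , n) ∷ E) c′
  invariant = record
    { k = k ; mate = mate′ ; L≤n = ℕP.m≤n⇒m≤1+n L≤n
    ; blue⇒<L = blue⇒<L′ ; <L⇒blue = λ i<L → trans (c′-old (ℕP.<-≤-trans i<L L≤n)) (<L⇒blue i<L)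
    ; mate< = mate<′ ; mate-involutive = mate′-involutive
    ; red-mate = red-mate′ ; black-mate = black-mate′
    ; edge< = edge<′ ; edge-red-or-cycle = edge-red-or-cycle′
    ; cycle⊆ = λ e∈ → there (cycle⊆ e∈) }

invariant : ∀ {n E c} → Produces n E c → Invariant n E c
invariant (start k)              = invariant-start k
invariant (step3 P u u<n)        = Step3.invariant (invariant P) u u<n
invariant (step4 P u u<n u-red)  = Step4.invariant (invariant P) u u<n u-red

independent-on-edge : (G : Graph n) → ∀ {S a b x y} → Independent G S → x ∈ S → y ∈ S →
                      Adj G a b → x ≡ a ⊎ x ≡ b → y ≡ a ⊎ y ≡ b → x ≡ y
independent-on-edge _ ind x∈ y∈ a (inj₁ refl) (inj₁ refl) = refl
independent-on-edge _ ind x∈ y∈ a (inj₁ refl) (inj₂ refl) = ⊥-elim (ind _ _ x∈ y∈ a)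
independent-on-edge _ ind x∈ y∈ a (inj₂ refl) (inj₁ refl) = ⊥-elim (ind _ _ y∈ x∈ a)
independent-on-edge _ ind x∈ y∈ a (inj₂ refl) (inj₂ refl) = refl

isCol⇒≡ : ∀ a b → isCol a b ≡ true → b ≡ a
isCol⇒≡ blue  blue  _ = refl
isCol⇒≡ red   red   _ = refl
isCol⇒≡ black black _ = refl

isCol-refl : ∀ a → isCol a a ≡ true
isCol-refl blue  = refl
isCol-refl red   = refl
isCol-refl black = refl

module ProducedGraph {n} (G : Graph n) {E c} (I : Invariant n E c)
                     (σ : Fin n ↔ Fin n) (iso : IsoTo G E σ) where
  open Invariant I
  open Inverse σ using (to; from; strictlyInverseˡ; strictlyInverseʳ)

  V : Set
  V = Fin n

  label : V → ℕ
  label v = toℕ (from v)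

  label< : ∀ v → label v < n
  label< v = FinP.toℕ<n (from v)

  label-injective : ∀ {u v} → label u ≡ label v → u ≡ v
  label-injective {u} {v} eq = trans (sym (strictlyInverseˡ u))
    (trans (cong to (FinP.toℕ-injective eq)) (strictlyInverseˡ v))

  -- out-of-range labels are sent to the vertex labelled 0
  vertex : ℕ → V
  vertex i with i <? n
  ... | yes i<n = to (fromℕ< i<n)
  ... | no  _   = to (fromℕ< (ℕP.<-≤-trans (s≤s z≤n) L≤n))

  label-vertex : ∀ {i} → i < n → label (vertex i) ≡ i
  label-vertex {i} i<n with i <? n
  ... | yes i<n′ = trans (cong toℕ (strictlyInverseʳ (fromℕ< i<n′))) (FinP.toℕ-fromℕ< i<n′)
  ... | no  i≮n  = ⊥-elim (i≮n i<n)

  vertex-label : ∀ v → vertex (label v) ≡ v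
  vertex-label v = label-injective (label-vertex (label< v))

  Adj⇒PAdj : ∀ {u v} → Adj G u v → PAdj E (label u) (label v)
  Adj⇒PAdj {u} {v} a = Equivalence.to (iso (from u) (from v))
    (subst₂ (Adj G) (sym (strictlyInverseˡ u)) (sym (strictlyInverseˡ v)) a)

  PAdj⇒Adj : ∀ {u v} → PAdj E (label u) (label v) → Adj G u v
  PAdj⇒Adj {u} {v} p = subst₂ (Adj G) (strictlyInverseˡ u) (strictlyInverseˡ v)
    (Equivalence.from (iso (from u) (from v)) p)

  colour : V → Colour
  colour v = c (label v)

  class : Colour → Subset n
  class = colourClass σ c

  ∈-class⁺ : ∀ {a v} → colour v ≡ a → v ∈ class a
  ∈-class⁺ {a} refl = ∈-tabulate⁺ (isCol-refl a)

  ∈-class⁻ : ∀ {a v} → v ∈ class a → colour v ≡ a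
  ∈-class⁻ {a} {v} v∈ = isCol⇒≡ a (colour v) (∈-tabulate⁻ v∈)

  B R C : Subset n
  B = class black
  R = class red
  C = class blue

  blue⇒label<L : ∀ {v} → colour v ≡ blue → label v < L
  blue⇒label<L {v} = blue⇒<L (label< v)

  edge-red-or-cycleᵛ : ∀ {u v} → Adj G u v →
                       colour u ≡ red ⊎ colour v ≡ red ⊎ CycleAdj (label u) (label v)
  edge-red-or-cycleᵛ = edge-red-or-cycle ∘ Adj⇒PAdj

  nonred-edge⇒blue : ∀ {u v} → Adj G u v → colour u ≢ red → colour v ≢ red →
                     colour u ≡ blue × colour v ≡ blue
  nonred-edge⇒blue a u≢red v≢red with edge-red-or-cycleᵛ a
  ... | inj₁ u-red        = ⊥-elim (u≢red u-red)
  ... | inj₂ (inj₁ v-red) = ⊥-elim (v≢red v-red)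
  ... | inj₂ (inj₂ ca)    = let u< , v< = CycleAdj⇒< ca in <L⇒blue u< , <L⇒blue v<

  CycleAdj⇒PAdj : ∀ {i j} → CycleAdj i j → PAdj E i j
  CycleAdj⇒PAdj (inj₁ e∈) = inj₁ (cycle⊆ e∈)
  CycleAdj⇒PAdj (inj₂ e∈) = inj₂ (cycle⊆ e∈)

  mateᵛ : V → V
  mateᵛ v = vertex (mate (label v))

  label-mate : ∀ v → label (mateᵛ v) ≡ mate (label v)
  label-mate v = label-vertex (mate< (label< v))

  mateᵛ-involutive : ∀ v → mateᵛ (mateᵛ v) ≡ v
  mateᵛ-involutive v = label-injective (begin
    label (mateᵛ (mateᵛ v)) ≡⟨ label-mate (mateᵛ v) ⟩
    mate (label (mateᵛ v))  ≡⟨ cong mate (label-mate v) ⟩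
    mate (mate (label v))   ≡⟨ mate-involutive (label< v) ⟩
    label v                 ∎)
    where open ≡-Reasoning

  mateᵛ-injective : ∀ {u v} → mateᵛ u ≡ mateᵛ v → u ≡ v
  mateᵛ-injective {u} {v} eq =
    trans (sym (mateᵛ-involutive u)) (trans (cong mateᵛ eq) (mateᵛ-involutive v))

  red⇒mate-black : ∀ {v} → colour v ≡ red → colour (mateᵛ v) ≡ black
  red⇒mate-black {v} v-red =
    subst (λ i → c i ≡ black) (sym (label-mate v)) (proj₁ (red-mate (label< v) v-red))

  red⇒mate-adjacent : ∀ {v} → colour v ≡ red → Adj G v (mateᵛ v)
  red⇒mate-adjacent {v} v-red =
    PAdj⇒Adj (subst (PAdj E (label v)) (sym (label-mate v)) (proj₂ (red-mate (label< v) v-red)))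

  black⇒mate : ∀ {v} → colour v ≡ black → mateᵛ v ≡ v ⊎ colour (mateᵛ v) ≡ red
  black⇒mate {v} v-black with black-mate (label< v) v-black
  ... | inj₁ fixed = inj₁ (label-injective (trans (label-mate v) fixed))
  ... | inj₂ red′  = inj₂ (subst (λ i → c i ≡ red) (sym (label-mate v)) red′)

  black⇒mate-adjacent : ∀ {v} → colour v ≡ black → mateᵛ v ≢ v → Adj G v (mateᵛ v)
  black⇒mate-adjacent {v} v-black mate≢v with black⇒mate v-black
  ... | inj₁ fixed    = ⊥-elim (mate≢v fixed)
  ... | inj₂ mate-red = Graph.sym G
    (subst (Adj G (mateᵛ v)) (mateᵛ-involutive v) (red⇒mate-adjacent mate-red))

  black-neighbour-red : ∀ {u v} → colour u ≡ black → Adj G u v → colour v ≡ red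
  black-neighbour-red u-black a with edge-red-or-cycleᵛ a
  ... | inj₁ u-red        = case trans (sym u-black) u-red of λ ()
  ... | inj₂ (inj₁ v-red) = v-red
  ... | inj₂ (inj₂ ca)    = case trans (sym u-black) (<L⇒blue (proj₁ (CycleAdj⇒< ca))) of λ ()

  nextᵛ : V → V
  nextᵛ v = vertex (next (label v))

  label-nextᵛ : ∀ {v} → colour v ≡ blue → label (nextᵛ v) ≡ next (label v)
  label-nextᵛ v-blue = label-vertex (ℕP.<-≤-trans (next< (blue⇒label<L v-blue)) L≤n)

  nextᵛ-blue : ∀ {v} → colour v ≡ blue → colour (nextᵛ v) ≡ blue
  nextᵛ-blue {v} v-blue =
    <L⇒blue (subst (_< L) (sym (label-nextᵛ v-blue)) (next< (blue⇒label<L v-blue)))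

  nextᵛ-adjacent : ∀ {v} → colour v ≡ blue → Adj G v (nextᵛ v)
  nextᵛ-adjacent {v} v-blue = PAdj⇒Adj (subst (PAdj E (label v)) (sym (label-nextᵛ v-blue))
    (CycleAdj⇒PAdj (next-adjacent (blue⇒label<L v-blue))))

  nextᵛ-injective : ∀ {u v} → colour u ≡ blue → colour v ≡ blue → nextᵛ u ≡ nextᵛ v → u ≡ v
  nextᵛ-injective u-blue v-blue eq = label-injective (next-injective
    (trans (sym (label-nextᵛ u-blue)) (trans (cong label eq) (label-nextᵛ v-blue))))

  nextᵛ≢ : ∀ {v} → colour v ≡ blue → nextᵛ v ≢ v
  nextᵛ≢ {v} v-blue eq = next≢ (label v) (trans (sym (label-nextᵛ v-blue)) (cong label eq))

  ∣C∣≤L : ∣ C ∣ ≤ L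
  ∣C∣≤L = subst₂ _≤_ (length-elements C) (trans (length-map vertex (upTo L)) (length-upTo L))
    (Unique∧⊆⇒length≤ (elements-Unique C) λ {v} v∈ →
      subst (_∈ₗ map vertex (upTo L)) (vertex-label v)
        (∈-map⁺ vertex (∈-upTo⁺ (blue⇒label<L (∈-class⁻ (∈-elements⁻ C v∈))))))

  -- Independence number

  evenVertex : ℕ → V
  evenVertex j = vertex (2 * j)

  evens : List V
  evens = map evenVertex (upTo (suc k))

  length-evens : length evens ≡ suc k
  length-evens = trans (length-map evenVertex (upTo (suc k))) (length-upTo (suc k))

  label-evenVertex : ∀ {j} → j ≤ k → label (evenVertex j) ≡ 2 * j
  label-evenVertex j≤k =
    label-vertex (ℕP.<-≤-trans (even<L j≤k) L≤n)

  ∈-evens⁻ : ∀ {v} → v ∈ₗ evens → ∃[ j ] (j ≤ k × label v ≡ 2 * j)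
  ∈-evens⁻ v∈ with ∈-map⁻ evenVertex v∈
  ... | j , j∈ , refl = let j≤k = ℕP.≤-pred (∈-upTo⁻ j∈) in j , j≤k , label-evenVertex j≤k

  evens-blue : ∀ {v} → v ∈ₗ evens → colour v ≡ blue
  evens-blue v∈ with ∈-evens⁻ v∈
  ... | j , j≤k , label≡ = <L⇒blue (subst (_< L) (sym label≡) (even<L j≤k))

  evens-Unique : Unique evens
  evens-Unique = Unique-map-local evenVertex (Unique.upTo⁺ (suc k)) λ i∈ j∈ eq →
    ℕP.*-cancelˡ-≡ _ _ 2 (trans (sym (label-evenVertex (ℕP.≤-pred (∈-upTo⁻ i∈))))
                         (trans (cong label eq) (label-evenVertex (ℕP.≤-pred (∈-upTo⁻ j∈)))))

  evens-or-black : ∀ {v} → v ∈ₗ evens ++ elements B →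
                   (∃[ j ] (j ≤ k × label v ≡ 2 * j)) ⊎ colour v ≡ black
  evens-or-black v∈ with ∈-++⁻ evens v∈
  ... | inj₁ v∈evens = inj₁ (∈-evens⁻ v∈evens)
  ... | inj₂ v∈B     = inj₂ (∈-class⁻ (∈-elements⁻ B v∈B))

  evens-or-black⇒nonred : ∀ {v} → v ∈ₗ evens ++ elements B → colour v ≢ red
  evens-or-black⇒nonred v∈ v-red with ∈-++⁻ evens v∈
  ... | inj₁ v∈evens = case trans (sym v-red) (evens-blue v∈evens) of λ ()
  ... | inj₂ v∈B     = case trans (sym v-red) (∈-class⁻ (∈-elements⁻ B v∈B)) of λ ()

  evens∪B-nonadjacent : ∀ {u v} → u ∈ₗ evens ++ elements B → v ∈ₗ evens ++ elements B → ¬ Adj G u v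
  evens∪B-nonadjacent u∈ v∈ a with evens-or-black u∈ | evens-or-black v∈
  ... | inj₂ u-black | _ = evens-or-black⇒nonred v∈ (black-neighbour-red u-black a)
  ... | _ | inj₂ v-black = evens-or-black⇒nonred u∈ (black-neighbour-red v-black (Graph.sym G a))
  ... | inj₁ (i , i≤k , u≡) | inj₁ (j , j≤k , v≡) with edge-red-or-cycleᵛ a
  ...   | inj₁ u-red        = evens-or-black⇒nonred u∈ u-red
  ...   | inj₂ (inj₁ v-red) = evens-or-black⇒nonred v∈ v-red
  ...   | inj₂ (inj₂ ca)    = even-nonadjacent i≤k j≤k (subst₂ CycleAdj u≡ v≡ ca)

  evens∪B-independent : Independent G (fromList (evens ++ elements B))
  evens∪B-independent _ _ u∈ v∈ = evens∪B-nonadjacent (∈-fromList⁻ _ u∈) (∈-fromList⁻ _ v∈)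

  evens∪B-size : suc k + ∣ B ∣ ≤ ∣ fromList (evens ++ elements B) ∣
  evens∪B-size = subst (_≤ ∣ fromList (evens ++ elements B) ∣)
    (trans (length-++ evens) (cong₂ _+_ length-evens (length-elements B)))
    (Unique⇒length≤∣fromList∣ (Unique.++⁺ evens-Unique (elements-Unique B) λ (v∈evens , v∈B) →
      case trans (sym (evens-blue v∈evens)) (∈-class⁻ (∈-elements⁻ B v∈B)) of λ ()))

  αChargeBy : Colour → V → List (V × Bool)
  αChargeBy blue  v = (v , false) ∷ (nextᵛ v , false) ∷ []
  αChargeBy red   v = (mateᵛ v , false) ∷ (mateᵛ v , true) ∷ []
  αChargeBy black v = (v , false) ∷ (v , true) ∷ []

  αCharge : V → List (V × Bool)
  αCharge v = αChargeBy (colour v) v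

  αCharge-Charge : ∀ v → Charge B C (αCharge v)
  αCharge-Charge v with colour v in v-colour
  ... | blue  = pair (∈-class⁺ v-colour) (∈-class⁺ (nextᵛ-blue v-colour)) (nextᵛ≢ v-colour ∘ sym)
  ... | red   = double (∈-class⁺ (red⇒mate-black v-colour))
  ... | black = double (∈-class⁺ v-colour)

  data Claims (x w : V) : Set where
    pendant : colour w ≡ black → x ≡ w ⊎ x ≡ mateᵛ w → Claims x w
    cycle   : colour x ≡ blue → w ≡ x ⊎ w ≡ nextᵛ x → Claims x w

  red-Claims-mate : ∀ {x} → colour x ≡ red → Claims x (mateᵛ x)
  red-Claims-mate {x} x-red = pendant (red⇒mate-black x-red) (inj₂ (sym (mateᵛ-involutive x)))

  αCharge-Claims : ∀ x {t} → t ∈ₗ αCharge x → Claims x (proj₁ t)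
  αCharge-Claims x t∈ with colour x in x-colour
  αCharge-Claims x (here refl)         | blue  = cycle x-colour (inj₁ refl)
  αCharge-Claims x (there (here refl)) | blue  = cycle x-colour (inj₂ refl)
  αCharge-Claims x (here refl)         | red   = red-Claims-mate x-colour
  αCharge-Claims x (there (here refl)) | red   = red-Claims-mate x-colour
  αCharge-Claims x (here refl)         | black = pendant x-colour (inj₁ refl)
  αCharge-Claims x (there (here refl)) | black = pendant x-colour (inj₁ refl)

  Claims-blue : ∀ {x w} → colour x ≡ blue → w ≡ x ⊎ w ≡ nextᵛ x → colour w ≡ blue
  Claims-blue x-blue (inj₁ refl) = x-blue
  Claims-blue x-blue (inj₂ refl) = nextᵛ-blue x-blue

  Claims-unique : ∀ {S x y w} → Independent G S → x ∈ S → y ∈ S → Claims x w → Claims y w → x ≡ y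
  Claims-unique ind x∈ y∈ (pendant w-black x∈e) (pendant _ y∈e) with mateᵛ _ FinP.≟ _
  ... | no  mate≢w = independent-on-edge G ind x∈ y∈ (black⇒mate-adjacent w-black mate≢w) x∈e y∈e
  ... | yes mate≡w = trans (collapse x∈e) (sym (collapse y∈e))
    where collapse : ∀ {z} → z ≡ _ ⊎ z ≡ mateᵛ _ → z ≡ _
          collapse (inj₁ z≡w)    = z≡w
          collapse (inj₂ z≡mate) = trans z≡mate mate≡w
  Claims-unique ind x∈ y∈ (pendant w-black _) (cycle y-blue w∈e) =
    case trans (sym w-black) (Claims-blue y-blue w∈e) of λ ()
  Claims-unique ind x∈ y∈ (cycle x-blue w∈e) (pendant w-black _) =
    case trans (sym w-black) (Claims-blue x-blue w∈e) of λ ()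
  Claims-unique ind x∈ y∈ (cycle x-blue (inj₁ refl)) (cycle y-blue (inj₁ w≡y)) = w≡y
  Claims-unique ind x∈ y∈ (cycle x-blue (inj₁ refl)) (cycle y-blue (inj₂ w≡ny)) =
    independent-on-edge G ind x∈ y∈ (nextᵛ-adjacent y-blue) (inj₂ w≡ny) (inj₁ refl)
  Claims-unique ind x∈ y∈ (cycle x-blue (inj₂ refl)) (cycle y-blue (inj₁ w≡y)) =
    independent-on-edge G ind x∈ y∈ (nextᵛ-adjacent x-blue) (inj₁ refl) (inj₂ (sym w≡y))
  Claims-unique ind x∈ y∈ (cycle x-blue (inj₂ refl)) (cycle y-blue (inj₂ w≡ny)) =
    nextᵛ-injective x-blue y-blue w≡ny

  independent-bound : ∀ {S} → Independent G S → ∣ S ∣ ≤ suc k + ∣ B ∣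
  independent-bound {S} ind = charge-count k
    (subst (λ m → 2 * m ≤ _) (length-elements S)
      (charging αCharge (elements S) unique (λ _ → αCharge-Charge _)))
    ∣C∣≤L
    where
    unique : Unique (concatMap αCharge (elements S))
    unique = concatMap-Unique αCharge (elements-Unique S) (λ _ → Charge-Unique (αCharge-Charge _))
      λ x∈ y∈ t∈x t∈y → Claims-unique ind (∈-elements⁻ S x∈) (∈-elements⁻ S y∈)
                                         (αCharge-Claims _ t∈x) (αCharge-Claims _ t∈y)

  α≡ : ∀ {a} → IsAlpha G a → a ≡ suc k + ∣ B ∣
  α≡ ((S , ind , refl) , maximal) = ℕP.≤-antisym (independent-bound ind)
    (ℕP.≤-trans evens∪B-size (maximal _ evens∪B-independent))

  -- Matching number

  red? : (v : V) → Dec (colour v ≡ red)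
  red? v with isCol red (colour v) in test
  ... | true  = yes (isCol⇒≡ red (colour v) test)
  ... | false = no λ v-red → case trans (sym test) (cong (isCol red) v-red) of λ ()

  μChargeBy : ∀ {P Q : Set} → Dec P → Dec Q → V × V → List (V × Bool)
  μChargeBy (yes _) _       (x , y) = (x , false) ∷ (x , true) ∷ []
  μChargeBy (no _)  (yes _) (x , y) = (y , false) ∷ (y , true) ∷ []
  μChargeBy (no _)  (no _)  (x , y) = (x , false) ∷ (y , false) ∷ []

  μCharge : V × V → List (V × Bool)
  μCharge (x , y) = μChargeBy (red? x) (red? y) (x , y)

  μCharge-Charge : ∀ {x y} → Adj G x y → Charge R C (μCharge (x , y))
  μCharge-Charge {x} {y} a with red? x | red? y
  ... | yes x-red | _         = double (∈-class⁺ x-red)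
  ... | no _      | yes y-red = double (∈-class⁺ y-red)
  ... | no x≢red  | no y≢red  = let x-blue , y-blue = nonred-edge⇒blue a x≢red y≢red in
    pair (∈-class⁺ x-blue) (∈-class⁺ y-blue) λ { refl → irrefl G a }

  μCharge-endpoint : ∀ e {t} → t ∈ₗ μCharge e → proj₁ t ∈ₗ proj₁ e ∷ proj₂ e ∷ []
  μCharge-endpoint (x , y) t∈ with red? x | red? y
  μCharge-endpoint (x , y) (here refl)         | yes _ | _     = here refl
  μCharge-endpoint (x , y) (there (here refl)) | yes _ | _     = here refl
  μCharge-endpoint (x , y) (here refl)         | no _  | yes _ = there (here refl)
  μCharge-endpoint (x , y) (there (here refl)) | no _  | yes _ = there (here refl)
  μCharge-endpoint (x , y) (here refl)         | no _  | no _  = here refl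
  μCharge-endpoint (x , y) (there (here refl)) | no _  | no _  = there (here refl)

  matching-bound : ∀ {M} → IsMatching G M → length M ≤ suc k + ∣ R ∣
  matching-bound {M} (adjacent , unique-ends) =
    charge-count k (charging μCharge M unique (μCharge-Charge ∘ All.lookup adjacent)) ∣C∣≤L
    where
    unique : Unique (concatMap μCharge M)
    unique = concatMap-Unique-along μCharge (λ e → proj₁ e ∷ proj₂ e ∷ []) proj₁ μCharge-endpoint M
      (Charge-Unique ∘ μCharge-Charge ∘ All.lookup adjacent) unique-ends

  oddVertex : ℕ → V
  oddVertex j = vertex (suc (2 * j))

  label-oddVertex : ∀ {j} → j ≤ k → label (oddVertex j) ≡ suc (2 * j)
  label-oddVertex j≤k = label-vertex (ℕP.<-≤-trans (odd<L j≤k) L≤n)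

  cycleEdge : ℕ → V × V
  cycleEdge j = evenVertex j , oddVertex j

  pendantEdge : V → V × V
  pendantEdge r = r , mateᵛ r

  ends : V × V → List V
  ends e = proj₁ e ∷ proj₂ e ∷ []

  maximumMatching : List (V × V)
  maximumMatching = map cycleEdge (upTo (suc k)) ++ map pendantEdge (elements R)

  cycleEdge-adjacent : ∀ {j} → j ≤ k → Adj G (evenVertex j) (oddVertex j)
  cycleEdge-adjacent j≤k = PAdj⇒Adj (subst₂ (PAdj E) (sym (label-evenVertex j≤k)) (sym (label-oddVertex j≤k))
    (CycleAdj⇒PAdj (inj₁ (succ-∈-oddCycleEdges (odd<L j≤k)))))

  maximumMatching-adjacent : All (uncurry (Adj G)) maximumMatching
  maximumMatching-adjacent = All.tabulate λ e∈ → case ∈-++⁻ (map cycleEdge (upTo (suc k))) e∈ of λ where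
    (inj₁ e∈cycle) → let j , j∈ , e≡ = ∈-map⁻ cycleEdge e∈cycle in
      subst (uncurry (Adj G)) (sym e≡) (cycleEdge-adjacent (ℕP.≤-pred (∈-upTo⁻ j∈)))
    (inj₂ e∈pendant) → let r , r∈ , e≡ = ∈-map⁻ pendantEdge e∈pendant in
      subst (uncurry (Adj G)) (sym e≡) (red⇒mate-adjacent (∈-class⁻ (∈-elements⁻ R r∈)))

  cycleEnd-label : ∀ {j w} → j ≤ k → w ∈ₗ ends (cycleEdge j) → label w ≡ 2 * j ⊎ label w ≡ suc (2 * j)
  cycleEnd-label j≤k (here refl)         = inj₁ (label-evenVertex j≤k)
  cycleEnd-label j≤k (there (here refl)) = inj₂ (label-oddVertex j≤k)

  cycleEnd-blue : ∀ {j w} → j ≤ k → w ∈ₗ ends (cycleEdge j) → colour w ≡ blue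
  cycleEnd-blue j≤k w∈ = <L⇒blue (case cycleEnd-label j≤k w∈ of λ where
    (inj₁ w≡) → subst (_< L) (sym w≡) (even<L j≤k)
    (inj₂ w≡) → subst (_< L) (sym w≡) (odd<L j≤k))

  cycleEnds-Unique : Unique (concatMap (ends ∘ cycleEdge) (upTo (suc k)))
  cycleEnds-Unique = concatMap-Unique (ends ∘ cycleEdge) (Unique.upTo⁺ (suc k))
    (λ {j} j∈ → let j≤k = ℕP.≤-pred (∈-upTo⁻ j∈) in Unique-pair λ even≡odd →
      ℕP.even≢odd j j (trans (sym (label-evenVertex j≤k)) (trans (cong label even≡odd) (label-oddVertex j≤k))))
    λ i∈ j∈ w∈i w∈j → halves-equal (cycleEnd-label (ℕP.≤-pred (∈-upTo⁻ i∈)) w∈i)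
                                   (cycleEnd-label (ℕP.≤-pred (∈-upTo⁻ j∈)) w∈j)

  pendantEnd : ∀ {r w} → colour r ≡ red → w ∈ₗ ends (pendantEdge r) →
               (w ≡ r × colour w ≡ red) ⊎ (w ≡ mateᵛ r × colour w ≡ black)
  pendantEnd r-red (here refl)         = inj₁ (refl , r-red)
  pendantEnd r-red (there (here refl)) = inj₂ (refl , red⇒mate-black r-red)

  pendantEnd-nonblue : ∀ {r w} → colour r ≡ red → w ∈ₗ ends (pendantEdge r) → colour w ≢ blue
  pendantEnd-nonblue r-red w∈ w-blue with pendantEnd r-red w∈
  ... | inj₁ (_ , w-red)   = case trans (sym w-red) w-blue of λ ()
  ... | inj₂ (_ , w-black) = case trans (sym w-black) w-blue of λ ()

  pendantEnds-Unique : Unique (concatMap (ends ∘ pendantEdge) (elements R))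
  pendantEnds-Unique = concatMap-Unique (ends ∘ pendantEdge) (elements-Unique R)
    (λ r∈ → let r-red = ∈-class⁻ (∈-elements⁻ R r∈) in Unique-pair λ r≡mate →
      case trans (sym r-red) (trans (cong colour r≡mate) (red⇒mate-black r-red)) of λ ())
    λ r∈ r′∈ w∈ w∈′ → case pendantEnd (∈-class⁻ (∈-elements⁻ R r∈)) w∈
                         , pendantEnd (∈-class⁻ (∈-elements⁻ R r′∈)) w∈′ of λ where
      (inj₁ (refl , _) , inj₁ (w≡r′ , _))         → w≡r′
      (inj₂ (refl , _) , inj₂ (w≡mate , _))       → mateᵛ-injective w≡mate
      (inj₁ (_ , w-red) , inj₂ (_ , w-black))     → case trans (sym w-red) w-black of λ ()
      (inj₂ (_ , w-black) , inj₁ (_ , w-red))     → case trans (sym w-red) w-black of λ ()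

  maximumMatching-isMatching : IsMatching G maximumMatching
  maximumMatching-isMatching = maximumMatching-adjacent , subst Unique (sym ends≡)
    (Unique.++⁺ cycleEnds-Unique pendantEnds-Unique λ (w∈cycle , w∈pendant) →
      let j , j∈ , w∈j = ∈-concatMap⁻′ (ends ∘ cycleEdge) (upTo (suc k)) w∈cycle
          r , r∈ , w∈r = ∈-concatMap⁻′ (ends ∘ pendantEdge) (elements R) w∈pendant
      in pendantEnd-nonblue (∈-class⁻ (∈-elements⁻ R r∈)) w∈r (cycleEnd-blue (ℕP.≤-pred (∈-upTo⁻ j∈)) w∈j))
    where
    ends≡ : endpoints G maximumMatching ≡
            concatMap (ends ∘ cycleEdge) (upTo (suc k)) ++ concatMap (ends ∘ pendantEdge) (elements R)
    ends≡ = trans (concatMap-++ ends (map cycleEdge (upTo (suc k))) (map pendantEdge (elements R)))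
                  (cong₂ _++_ (concatMap-map ends cycleEdge (upTo (suc k)))
                              (concatMap-map ends pendantEdge (elements R)))

  length-maximumMatching : length maximumMatching ≡ suc k + ∣ R ∣
  length-maximumMatching = begin
    length maximumMatching
      ≡⟨ length-++ (map cycleEdge (upTo (suc k))) ⟩
    length (map cycleEdge (upTo (suc k))) + length (map pendantEdge (elements R))
      ≡⟨ cong₂ _+_ (trans (length-map cycleEdge (upTo (suc k))) (length-upTo (suc k)))
                   (trans (length-map pendantEdge (elements R)) (length-elements R)) ⟩
    suc k + ∣ R ∣
      ∎
    where open ≡-Reasoning

  μ≡ : ∀ {m} → IsMu G m → m ≡ suc k + ∣ R ∣
  μ≡ ((M , matching , refl) , maximal) = ℕP.≤-antisym (matching-bound matching)
    (subst (_≤ length M) length-maximumMatching (maximal _ maximumMatching-isMatching))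

  -- Critical difference

  partnerBy : Colour → V → V
  partnerBy blue  = nextᵛ
  partnerBy red   = mateᵛ
  partnerBy black = mateᵛ

  partner : V → V
  partner v = partnerBy (colour v) v

  partner-cases : ∀ v → (colour v ≡ blue × partner v ≡ nextᵛ v) ⊎ (colour v ≢ blue × partner v ≡ mateᵛ v)
  partner-cases v with colour v in v-colour
  ... | blue  = inj₁ (refl , refl)
  ... | red   = inj₂ ((λ ()) , refl)
  ... | black = inj₂ ((λ ()) , refl)

  nonblue⇒mate-nonblue : ∀ {v} → colour v ≢ blue → colour (mateᵛ v) ≢ blue
  nonblue⇒mate-nonblue {v} v≢blue with colour v in v-colour
  ... | blue  = ⊥-elim (v≢blue refl)
  ... | red   = λ mate-blue → case trans (sym mate-blue) (red⇒mate-black v-colour) of λ ()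
  ... | black with black⇒mate v-colour
  ...   | inj₁ fixed    = λ mate-blue → case trans (sym (trans (cong colour fixed) v-colour)) mate-blue of λ ()
  ...   | inj₂ mate-red = λ mate-blue → case trans (sym mate-blue) mate-red of λ ()

  partner-preserves-blue : ∀ {x} → colour x ≡ blue → colour (partner x) ≡ blue
  partner-preserves-blue {x} x-blue with partner-cases x
  ... | inj₁ (_ , px)      = subst (λ w → colour w ≡ blue) (sym px) (nextᵛ-blue x-blue)
  ... | inj₂ (x≢blue , _)  = ⊥-elim (x≢blue x-blue)

  partner-reflects-blue : ∀ {x} → colour (partner x) ≡ blue → colour x ≡ blue
  partner-reflects-blue {x} partner-blue with partner-cases x
  ... | inj₁ (x-blue , _)  = x-blue
  ... | inj₂ (x≢blue , px) = ⊥-elim (nonblue⇒mate-nonblue x≢blue (subst (λ w → colour w ≡ blue) px partner-blue))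

  partner-injective : ∀ {x y} → partner x ≡ partner y → x ≡ y
  partner-injective {x} {y} eq with partner-cases x | partner-cases y
  ... | inj₁ (x-blue , px) | inj₁ (y-blue , py) = nextᵛ-injective x-blue y-blue (trans (sym px) (trans eq py))
  ... | inj₂ (_ , px)      | inj₂ (_ , py)      = mateᵛ-injective (trans (sym px) (trans eq py))
  ... | inj₁ (x-blue , _)  | inj₂ (y≢blue , _)  =
    ⊥-elim (y≢blue (partner-reflects-blue (subst (λ w → colour w ≡ blue) eq (partner-preserves-blue x-blue))))
  ... | inj₂ (x≢blue , _)  | inj₁ (y-blue , _)  =
    ⊥-elim (x≢blue (partner-reflects-blue (subst (λ w → colour w ≡ blue) (sym eq) (partner-preserves-blue y-blue))))

  partner-fixed⇒black : ∀ {x} → partner x ≡ x → colour x ≡ black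
  partner-fixed⇒black {x} fixed with colour x in x-colour
  ... | blue  = ⊥-elim (nextᵛ≢ x-colour fixed)
  ... | red   = case trans (sym (red⇒mate-black x-colour)) (trans (cong colour fixed) x-colour) of λ ()
  ... | black = refl

  partner-adjacent : ∀ {x} → partner x ≢ x → Adj G x (partner x)
  partner-adjacent {x} moved with colour x in x-colour
  ... | blue  = nextᵛ-adjacent x-colour
  ... | red   = red⇒mate-adjacent x-colour
  ... | black = black⇒mate-adjacent x-colour moved

  -- an injection X ⊎ R → N(X) ⊎ B, in the encoding of `tagged`
  deficiencyMap : V × Bool → V × Bool
  deficiencyMap (x , false) with partner x FinP.≟ x
  ... | yes _ = x , true
  ... | no  _ = partner x , false
  deficiencyMap (r , true) = mateᵛ r , true

  deficiencyMap-into : ∀ {X S′} → (∀ v → v ∈ S′ ⇔ N G X v) →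
                       ∀ {t} → t ∈ₗ tagged X R → deficiencyMap t ∈ₗ tagged S′ B
  deficiencyMap-into {X} {S′} S′⇔N {x , false} t∈ with partner x FinP.≟ x | ∈-tagged⁻ X R t∈
  ... | yes fixed | _ = ∈-taggedʳ⁺ S′ B (∈-class⁺ (partner-fixed⇒black fixed))
  ... | no  moved | inj₁ (_ , x∈X) =
    ∈-taggedˡ⁺ S′ B (Equivalence.from (S′⇔N (partner x)) (x , x∈X , partner-adjacent moved))
  deficiencyMap-into {X} {S′} S′⇔N {r , true} t∈ with ∈-tagged⁻ X R t∈
  ... | inj₂ (_ , r∈R) = ∈-taggedʳ⁺ S′ B (∈-class⁺ (red⇒mate-black (∈-class⁻ r∈R)))

  fixed-partner≢mate-of-red : ∀ {x r} → partner x ≡ x → colour r ≡ red → x ≢ mateᵛ r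
  fixed-partner≢mate-of-red {x} {r} fixed r-red refl with partner-cases x
  ... | inj₁ (x-blue , _) = case trans (sym x-blue) (partner-fixed⇒black fixed) of λ ()
  ... | inj₂ (_ , px) =
    case trans (sym r-red) (trans (cong colour r≡mate) (partner-fixed⇒black fixed)) of λ ()
    where r≡mate : r ≡ mateᵛ r
          r≡mate = trans (sym (mateᵛ-involutive r)) (trans (sym px) fixed)

  deficiencyMap-injective : ∀ {X t t′} → t ∈ₗ tagged X R → t′ ∈ₗ tagged X R →
                            deficiencyMap t ≡ deficiencyMap t′ → t ≡ t′
  deficiencyMap-injective {X} {x , false} {y , false} _ _ eq
    with partner x FinP.≟ x | partner y FinP.≟ y
  ... | yes _ | yes _ = cong (_, false) (,-injectiveˡ eq)
  ... | no  _ | no  _ = cong (_, false) (partner-injective (,-injectiveˡ eq))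
  ... | yes _ | no  _ = case ,-injectiveʳ eq of λ ()
  ... | no  _ | yes _ = case ,-injectiveʳ eq of λ ()
  deficiencyMap-injective {X} {x , false} {r , true} _ r∈ eq with partner x FinP.≟ x | ∈-tagged⁻ X R r∈
  ... | yes fixed | inj₂ (_ , r∈R) = ⊥-elim (fixed-partner≢mate-of-red fixed (∈-class⁻ r∈R) (,-injectiveˡ eq))
  ... | no  _     | _              = case ,-injectiveʳ eq of λ ()
  deficiencyMap-injective {X} {r , true} {x , false} r∈ _ eq with partner x FinP.≟ x | ∈-tagged⁻ X R r∈
  ... | yes fixed | inj₂ (_ , r∈R) = ⊥-elim (fixed-partner≢mate-of-red fixed (∈-class⁻ r∈R) (sym (,-injectiveˡ eq)))
  ... | no  _     | _              = case ,-injectiveʳ eq of λ ()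
  deficiencyMap-injective {X} {r , true} {r′ , true} _ _ eq = cong (_, true) (mateᵛ-injective (,-injectiveˡ eq))

  deficiency-bound : ∀ {X S′} → (∀ v → v ∈ S′ ⇔ N G X v) → ∣ X ∣ + ∣ R ∣ ≤ ∣ S′ ∣ + ∣ B ∣
  deficiency-bound {X} {S′} S′⇔N = subst₂ _≤_
    (trans (length-map deficiencyMap (tagged X R)) (length-tagged X R)) (length-tagged S′ B)
    (Unique∧⊆⇒length≤ (Unique-map-local deficiencyMap (tagged-Unique X R) (deficiencyMap-injective {X}))
      λ t∈ → let t₀ , t₀∈ , t≡ = ∈-map⁻ deficiencyMap t∈ in
        subst (_∈ₗ tagged S′ B) (sym t≡) (deficiencyMap-into S′⇔N t₀∈))

  R⇔N[B] : ∀ v → v ∈ R ⇔ N G B v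
  R⇔N[B] v = mk⇔
    (λ v∈R → let v-red = ∈-class⁻ v∈R in
      mateᵛ v , ∈-class⁺ (red⇒mate-black v-red) , Graph.sym G (red⇒mate-adjacent v-red))
    (λ (w , w∈B , a) → ∈-class⁺ (black-neighbour-red (∈-class⁻ w∈B) a))

  d[B] : IsD G B (+ ∣ B ∣ - + ∣ R ∣)
  d[B] = ∣ R ∣ , (R , R⇔N[B] , refl) , refl

  dc≡ : ∀ {d} → IsDc G d → d ≡ + ∣ B ∣ - + ∣ R ∣
  dc≡ ((X , _ , (S′ , S′⇔N , refl) , refl) , maximal) =
    ℤP.≤-antisym ([+x]-[+k]≤[+b]-[+r] (∣ X ∣) (∣ S′ ∣) (∣ B ∣) (∣ R ∣) (deficiency-bound S′⇔N))
                 (maximal B _ d[B])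

corollary4p15 : ∀ {n : ℕ} (G : Graph n) →
    Connected G → Unicyclic G → ¬ KonigEgervary G →
    ∀ (E : List (ℕ × ℕ)) (c : ℕ → Colour) → Produces n E c →
    ∀ (σ : Fin n ↔ Fin n) → IsoTo G E σ →
    ∀ (d : ℤ) (a m : ℕ) → IsDc G d → IsAlpha G a → IsMu G m →
    (d ≡ (+ ∣ colourClass σ c black ∣) - (+ ∣ colourClass σ c red ∣))
    × ((+ ∣ colourClass σ c black ∣) - (+ ∣ colourClass σ c red ∣) ≡ (+ a) - (+ m))
corollary4p15 G _ _ _ E c produces σ iso d a m dc α μ =
  dc≡ dc , sym (begin
    + a - + m                             ≡⟨ cong₂ (λ a m → + a - + m) (α≡ α) (μ≡ μ) ⟩
    + (suc k + ∣ B ∣) - + (suc k + ∣ R ∣) ≡⟨ [+m+x]-[+m+y]≡[+x]-[+y] (suc k) (∣ B ∣) (∣ R ∣) ⟩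
    + ∣ B ∣ - + ∣ R ∣                     ∎)
  where
  open Invariant (invariant produces) using (k)
  open ProducedGraph G (invariant produces) σ iso
  open ≡-Reasoning
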